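{- Let $I$ be a finite set of positive integers and $0 \leq r \leq |I|$. Then: (i) $H_r(I)$ is $2$-compressed; (ii) if $H_r(I) \subseteq A \subseteq \mathbb{F}_2^I$ and $J \subseteq I$ with $|J|\le 2$, then $H_r(I) \subseteq C_J(A)$; (iii) if $A \subseteq H_r(I)$ and $J\subseteq I$ with $|J|\le 2$, then $C_J(A) \subseteq H_r(I)$.
   Context: $\mathbb{F}_2^I$ is the vector space of tuples $(x_i)_{i\in I}$ over $\mathbb{F}_2$. The Hamming norm $\|x\|$ is the number of $i$ with $x_i=1$, and $H_r(I)=\{x:\|x\|\le r\}$. Lex order on $\mathbb{F}_2^J$: $x\prec y$ iff at the largest $j$ with $x_j\ne y_j$ one has $x_j=0,y_j=1$. Writing $\mathbb{F}_2^I=\mathbb{F}_2^{I\setminus J}\times\mathbb{F}_2^J$ and, for $x\in\mathbb{F}_2^{I\setminus J}$, $A_x=\{y\in\mathbb{F}_2^J:(x,y)\in A\}$, the $J$-compression $C_J(A)$ replaces each fibre $A_x$ by the first $|A_x|$ elements of $\mathbb{F}_2^J$ in lex order. $A$ is $J$-compressed if $C_J(A)=A$, and $2$-compressed if it is $J$-compressed for every $J\subseteq I$ with $|J|\le 2$. -}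

module Defs where

open import Data.Bool using (Bool; true; false; _∧_; _∨_; not; if_then_else_)
open import Data.Nat using (ℕ; zero; suc; _+_; _≤ᵇ_; _<ᵇ_)
open import Data.List using (List; []; _∷_; [_]; map; _++_; length; filterᵇ)
open import Data.Vec using (Vec; []; _∷_)
open import Relation.Binary.PropositionalEquality using (_≡_)

-- The index set I (a finite set of positive integers with its natural order)
-- is modelled, up to order isomorphism, by {0,...,n-1} with n = |I|.
-- An element x of F_2^I is a Vec Bool n (position i = coordinate x_i).
Family : ℕ → Set
Family n = Vec Bool n → Bool

_∈F_ : ∀ {n} → Vec Bool n → Family n → Set
x ∈F A = A x ≡ true

_⊆F_ : ∀ {n} → Family n → Family n → Set
A ⊆F B = ∀ x → x ∈F A → x ∈F B

cube : (n : ℕ) → List (Vec Bool n)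
cube zero = [ [] ]
cube (suc n) = map (false ∷_) (cube n) ++ map (true ∷_) (cube n)

count : ∀ {n} → Family n → ℕ
count {n} P = length (filterᵇ P (cube n))

norm : ∀ {n} → Vec Bool n → ℕ
norm [] = 0
norm (true ∷ xs) = suc (norm xs)
norm (false ∷ xs) = norm xs

H : ∀ {n} → ℕ → Family n
H r x = norm x ≤ᵇ r

-- A subset J ⊆ I is also a Vec Bool n (indicator); |J| = norm J.
-- w is supported in J (so w represents an element of F_2^J)
supp⊆ : ∀ {n} → Vec Bool n → Vec Bool n → Bool
supp⊆ [] [] = true
supp⊆ (w ∷ ws) (j ∷ js) = (not w ∨ j) ∧ supp⊆ ws js

-- (x , w) : coordinates in J taken from w, coordinates outside J from x
merge : ∀ {n} → Vec Bool n → Vec Bool n → Vec Bool n → Vec Bool n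
merge [] [] [] = []
merge (j ∷ js) (x ∷ xs) (w ∷ ws) = (if j then w else x) ∷ merge js xs ws

restrict : ∀ {n} → Vec Bool n → Vec Bool n → Vec Bool n
restrict [] [] = []
restrict (j ∷ js) (z ∷ zs) = (j ∧ z) ∷ restrict js zs

eqᵇ : ∀ {n} → Vec Bool n → Vec Bool n → Bool
eqᵇ [] [] = true
eqᵇ (x ∷ xs) (y ∷ ys) = (if x then y else not y) ∧ eqᵇ xs ys

-- lex order: x ≺ y iff at the largest coordinate where they differ, x is 0 and y is 1
lexLt : ∀ {n} → Vec Bool n → Vec Bool n → Bool
lexLt [] [] = false
lexLt (x ∷ xs) (y ∷ ys) = lexLt xs ys ∨ (eqᵇ xs ys ∧ (not x ∧ y))

-- |A_x| where x is the part of z outside J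
fibreSize : ∀ {n} → Vec Bool n → Family n → Vec Bool n → ℕ
fibreSize J A z = count (λ w → supp⊆ w J ∧ A (merge J z w))

lexRank : ∀ {n} → Vec Bool n → Vec Bool n → ℕ
lexRank J z = count (λ w → supp⊆ w J ∧ lexLt w (restrict J z))

-- J-compression: z = (x , y) ∈ C_J(A) iff y is among the first |A_x|
-- elements of F_2^J in lex order
C : ∀ {n} → Vec Bool n → Family n → Family n
C J A z = lexRank J z <ᵇ fibreSize J A z

JCompressed : ∀ {n} → Vec Bool n → Family n → Set
JCompressed J A = ∀ z → C J A z ≡ A z

TwoCompressed : ∀ {n} → Family n → Set
TwoCompressed {n} A = (J : Vec Bool n) → norm J Data.Nat.≤ 2 → JCompressed J A

-- For |J| ≤ 2 the lex order on F_2^J is 0 ≺ e_i ≺ e_j ≺ e_i + e_j (i < j), and the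
-- Hamming norm is non-decreasing along it. Hence every fibre of H_r over F_2^(I∖J) is a
-- lex-initial segment of F_2^J, which is exactly what makes H_r J-compressed. Parts (ii)
-- and (iii) follow because J-compression is monotone under inclusion and fixes H_r.
module Submission where

open import Defs
open import Data.Nat using (ℕ; suc; _≤_; _<_; z≤n; s≤s; _<ᵇ_)
open import Data.Nat.Properties
  using (≤-trans; <⇒≤; <⇒≱; <-≤-trans; n<1+n; n≤1+n; m≤n⇒m≤1+n; <⇒<ᵇ; <ᵇ⇒<; <ᵇ-reflects-<; ≤⇒≤ᵇ; ≤ᵇ⇒≤)
open import Data.Bool using (Bool; true; false; _∧_; _∨_; not)
open import Data.Bool.Properties using (T-≡; ∧-zeroʳ; ∨-identityʳ; ¬-not; _≟_)
open import Data.Vec using (Vec; []; _∷_)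
open import Data.List using ([]; _∷_; map; length; filterᵇ)
open import Data.List.Membership.Propositional using (_∈_)
open import Data.List.Membership.Propositional.Properties using (∈-map⁺; ∈-++⁺ˡ; ∈-++⁺ʳ)
open import Data.List.Relation.Unary.Any using (here; there)
open import Data.Product using (_×_; _,_; proj₂)
open import Data.Sum using (_⊎_; inj₁; inj₂)
open import Data.Empty using (⊥-elim)
open import Relation.Nullary.Negation using (¬_)
open import Function.Bundles using (Equivalence)
open import Relation.Nullary.Reflects using (ofʸ)
open import Relation.Nullary.Decidable using (yes; no)
open import Relation.Binary.PropositionalEquality using (_≡_; refl; sym; trans; cong; subst)

open Equivalence using (to; from)

∧≡true⁻ : ∀ {a b} → a ∧ b ≡ true → a ≡ true × b ≡ true
∧≡true⁻ {true} {true} refl = refl , refl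

∧≡true⁺ : ∀ {a b} → a ≡ true → b ≡ true → a ∧ b ≡ true
∧≡true⁺ refl refl = refl

<ᵇ≡true : ∀ {m n} → m < n → (m <ᵇ n) ≡ true
<ᵇ≡true m<n = T-≡ .to (<⇒<ᵇ m<n)

<ᵇ≡true⁻ : ∀ {m n} → (m <ᵇ n) ≡ true → m < n
<ᵇ≡true⁻ {m} {n} p = <ᵇ⇒< m n (T-≡ .from p)

<ᵇ≡false : ∀ {m n} → n ≤ m → (m <ᵇ n) ≡ false
<ᵇ≡false {m} {n} n≤m with m <ᵇ n | <ᵇ-reflects-< m n
... | false | _        = refl
... | true  | ofʸ m<n = ⊥-elim (<⇒≱ m<n n≤m)

module _ {A : Set} (P Q : A → Bool) (P⇒Q : ∀ x → P x ≡ true → Q x ≡ true) where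

  length-filterᵇ-≤ : ∀ xs → length (filterᵇ P xs) ≤ length (filterᵇ Q xs)
  length-filterᵇ-≤ [] = z≤n
  length-filterᵇ-≤ (x ∷ xs) with P x in Px
  ... | true rewrite P⇒Q x Px = s≤s (length-filterᵇ-≤ xs)
  ... | false with Q x
  ...   | true  = m≤n⇒m≤1+n (length-filterᵇ-≤ xs)
  ...   | false = length-filterᵇ-≤ xs

  length-filterᵇ-< : ∀ {y xs} → y ∈ xs → P y ≡ false → Q y ≡ true →
                     length (filterᵇ P xs) < length (filterᵇ Q xs)
  length-filterᵇ-< {xs = _ ∷ xs} (here refl) Py Qy rewrite Py | Qy = s≤s (length-filterᵇ-≤ xs)
  length-filterᵇ-< {xs = x ∷ xs} (there y∈xs) Py Qy with P x in Px
  ... | true rewrite P⇒Q x Px = s≤s (length-filterᵇ-< y∈xs Py Qy)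
  ... | false with Q x
  ...   | true  = m≤n⇒m≤1+n (length-filterᵇ-< y∈xs Py Qy)
  ...   | false = length-filterᵇ-< y∈xs Py Qy

∈-cube : ∀ {n} (x : Vec Bool n) → x ∈ cube n
∈-cube [] = here refl
∈-cube {suc n} (false ∷ x) = ∈-++⁺ˡ (∈-map⁺ (false ∷_) (∈-cube x))
∈-cube {suc n} (true ∷ x) = ∈-++⁺ʳ (map (false ∷_) (cube n)) (∈-map⁺ (true ∷_) (∈-cube x))

count-mono : ∀ {n} {P Q : Family n} → P ⊆F Q → count P ≤ count Q
count-mono {n} {P} {Q} P⊆Q = length-filterᵇ-≤ P Q P⊆Q (cube n)

count-mono-< : ∀ {n} {P Q : Family n} {y} → P ⊆F Q → P y ≡ false → y ∈F Q → count P < count Q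
count-mono-< {n} {P} {Q} {y} P⊆Q = length-filterᵇ-< P Q P⊆Q (∈-cube y)

data SupportedIn : ∀ {n} → Vec Bool n → Vec Bool n → Set where
  []   : SupportedIn [] []
  skip : ∀ {n} {x J : Vec Bool n} → SupportedIn x J → SupportedIn (false ∷ x) (false ∷ J)
  keep : ∀ {n} {x J : Vec Bool n} a → SupportedIn x J → SupportedIn (a ∷ x) (true ∷ J)

supp⊆⇒SupportedIn : ∀ {n} (x J : Vec Bool n) → supp⊆ x J ≡ true → SupportedIn x J
supp⊆⇒SupportedIn [] [] _ = []
supp⊆⇒SupportedIn (false ∷ x) (false ∷ J) x⊆J = skip (supp⊆⇒SupportedIn x J x⊆J)
supp⊆⇒SupportedIn (a ∷ x) (true ∷ J) x⊆J = keep a (supp⊆⇒SupportedIn x J (proj₂ (∧≡true⁻ {not a ∨ true} x⊆J)))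

supp⊆-restrict : ∀ {n} (J z : Vec Bool n) → supp⊆ (restrict J z) J ≡ true
supp⊆-restrict [] [] = refl
supp⊆-restrict (true ∷ J) (true ∷ z) = supp⊆-restrict J z
supp⊆-restrict (true ∷ J) (false ∷ z) = supp⊆-restrict J z
supp⊆-restrict (false ∷ J) (_ ∷ z) = supp⊆-restrict J z

merge-restrict : ∀ {n} (J z : Vec Bool n) → merge J z (restrict J z) ≡ z
merge-restrict [] [] = refl
merge-restrict (true ∷ J) (true ∷ z) = cong (true ∷_) (merge-restrict J z)
merge-restrict (true ∷ J) (false ∷ z) = cong (false ∷_) (merge-restrict J z)
merge-restrict (false ∷ J) (c ∷ z) = cong (c ∷_) (merge-restrict J z)

eqᵇ-refl : ∀ {n} (x : Vec Bool n) → eqᵇ x x ≡ true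
eqᵇ-refl [] = refl
eqᵇ-refl (true ∷ x) = eqᵇ-refl x
eqᵇ-refl (false ∷ x) = eqᵇ-refl x

eqᵇ⇒≡ : ∀ {n} (x y : Vec Bool n) → eqᵇ x y ≡ true → x ≡ y
eqᵇ⇒≡ [] [] _ = refl
eqᵇ⇒≡ (true ∷ x) (true ∷ y) p = cong (true ∷_) (eqᵇ⇒≡ x y p)
eqᵇ⇒≡ (false ∷ x) (false ∷ y) p = cong (false ∷_) (eqᵇ⇒≡ x y p)

lexLt-irrefl : ∀ {n} (x : Vec Bool n) → lexLt x x ≡ false
lexLt-irrefl [] = refl
lexLt-irrefl (a ∷ x) rewrite lexLt-irrefl x | eqᵇ-refl x with a
... | true  = refl
... | false = refl

lexLt-same-tail : ∀ {n} a b (x : Vec Bool n) → lexLt (a ∷ x) (b ∷ x) ≡ not a ∧ b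
lexLt-same-tail a b x rewrite lexLt-irrefl x | eqᵇ-refl x = refl

lexLt-∷⁻ : ∀ {n} a b (x y : Vec Bool n) → lexLt (a ∷ x) (b ∷ y) ≡ true →
           lexLt x y ≡ true ⊎ (x ≡ y × a ≡ false × b ≡ true)
lexLt-∷⁻ a b x y p with lexLt x y
... | true  = inj₁ refl
... | false with eqᵇ x y in x≡ᵇy | a | b | p
...   | true | false | true | _ = inj₂ (eqᵇ⇒≡ x y x≡ᵇy , refl , refl)

lexLt-∷⁺ : ∀ {n} a b (x y : Vec Bool n) → lexLt x y ≡ true → lexLt (a ∷ x) (b ∷ y) ≡ true
lexLt-∷⁺ a b x y x≺y rewrite x≺y = refl

lexLt-∷-false : ∀ {n} (x y : Vec Bool n) → lexLt (false ∷ x) (false ∷ y) ≡ lexLt x y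
lexLt-∷-false x y rewrite ∧-zeroʳ (eqᵇ x y) = ∨-identityʳ (lexLt x y)

lexLt-trichotomy : ∀ {n} (x y : Vec Bool n) → lexLt x y ≡ true ⊎ x ≡ y ⊎ lexLt y x ≡ true
lexLt-trichotomy [] [] = inj₂ (inj₁ refl)
lexLt-trichotomy (a ∷ x) (b ∷ y) with lexLt-trichotomy x y
... | inj₁ x≺y = inj₁ (lexLt-∷⁺ a b x y x≺y)
... | inj₂ (inj₂ y≺x) = inj₂ (inj₂ (lexLt-∷⁺ b a y x y≺x))
... | inj₂ (inj₁ refl) with a | b
...   | false | false = inj₂ (inj₁ refl)
...   | false | true  = inj₁ (lexLt-same-tail false true x)
...   | true  | false = inj₂ (inj₂ (lexLt-same-tail false true x))
...   | true  | true  = inj₂ (inj₁ refl)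

norm-∷-monoʳ-< : ∀ {n} c {x y : Vec Bool n} → norm x < norm y → norm (c ∷ x) < norm (c ∷ y)
norm-∷-monoʳ-< true  = s≤s
norm-∷-monoʳ-< false x<y = x<y

norm-∷-monoʳ-≤ : ∀ {n} c {x y : Vec Bool n} → norm x ≤ norm y → norm (c ∷ x) ≤ norm (c ∷ y)
norm-∷-monoʳ-≤ true  = s≤s
norm-∷-monoʳ-≤ false x≤y = x≤y

norm-∷-≤ : ∀ {n} a b {x y : Vec Bool n} → norm x < norm y → norm (a ∷ x) ≤ norm (b ∷ y)
norm-∷-≤ false false x<y = <⇒≤ x<y
norm-∷-≤ false true  x<y = m≤n⇒m≤1+n (<⇒≤ x<y)
norm-∷-≤ true  false x<y = x<y
norm-∷-≤ true  true  x<y = s≤s (<⇒≤ x<y)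

¬lexLt-within-∅ : ∀ {n} {J x y : Vec Bool n} → norm J ≤ 0 →
                  SupportedIn x J → SupportedIn y J → ¬ lexLt x y ≡ true
¬lexLt-within-∅ _ [] [] ()
¬lexLt-within-∅ ∣J∣≤0 (skip {x = x} x⊆J) (skip {x = y} y⊆J) x≺y =
  ¬lexLt-within-∅ ∣J∣≤0 x⊆J y⊆J (trans (sym (lexLt-∷-false x y)) x≺y)

lexLt⇒norm-merge-< : ∀ {n} (J z x y : Vec Bool n) → norm J ≤ 1 →
                     SupportedIn x J → SupportedIn y J → lexLt x y ≡ true →
                     norm (merge J z x) < norm (merge J z y)
lexLt⇒norm-merge-< [] [] [] [] _ [] [] ()
lexLt⇒norm-merge-< (true ∷ J) (c ∷ z) (a ∷ x) (b ∷ y) (s≤s ∣J∣≤0) (keep a x⊆J) (keep b y⊆J) x≺y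
  with lexLt-∷⁻ a b x y x≺y
... | inj₁ tail≺ = ⊥-elim (¬lexLt-within-∅ ∣J∣≤0 x⊆J y⊆J tail≺)
... | inj₂ (refl , refl , refl) = n<1+n _
lexLt⇒norm-merge-< (false ∷ J) (c ∷ z) (false ∷ x) (false ∷ y) ∣J∣≤1 (skip x⊆J) (skip y⊆J) x≺y =
  norm-∷-monoʳ-< c (lexLt⇒norm-merge-< J z x y ∣J∣≤1 x⊆J y⊆J (trans (sym (lexLt-∷-false x y)) x≺y))

lexLt⇒norm-merge-≤ : ∀ {n} (J z x y : Vec Bool n) → norm J ≤ 2 →
                     SupportedIn x J → SupportedIn y J → lexLt x y ≡ true →
                     norm (merge J z x) ≤ norm (merge J z y)
lexLt⇒norm-merge-≤ [] [] [] [] _ [] [] ()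
lexLt⇒norm-merge-≤ (true ∷ J) (c ∷ z) (a ∷ x) (b ∷ y) (s≤s ∣J∣≤1) (keep a x⊆J) (keep b y⊆J) x≺y
  with lexLt-∷⁻ a b x y x≺y
... | inj₁ tail≺ = norm-∷-≤ a b (lexLt⇒norm-merge-< J z x y ∣J∣≤1 x⊆J y⊆J tail≺)
... | inj₂ (refl , refl , refl) = n≤1+n _
lexLt⇒norm-merge-≤ (false ∷ J) (c ∷ z) (false ∷ x) (false ∷ y) ∣J∣≤2 (skip x⊆J) (skip y⊆J) x≺y =
  norm-∷-monoʳ-≤ c (lexLt⇒norm-merge-≤ J z x y ∣J∣≤2 x⊆J y⊆J (trans (sym (lexLt-∷-false x y)) x≺y))

H-≤-closed : ∀ {n} r (x y : Vec Bool n) → norm x ≤ norm y → y ∈F H r → x ∈F H r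
H-≤-closed r x y x≤y y∈H = T-≡ .to (≤⇒≤ᵇ (≤-trans x≤y (≤ᵇ⇒≤ (norm y) r (T-≡ .from y∈H))))

-- fibreSize J A z and lexRank J z unfold to the counts of these two families.
fibre : ∀ {n} → Vec Bool n → Family n → Vec Bool n → Family n
fibre J A z w = supp⊆ w J ∧ A (merge J z w)

lexPredecessors : ∀ {n} → Vec Bool n → Vec Bool n → Family n
lexPredecessors J z w = supp⊆ w J ∧ lexLt w (restrict J z)

LexDownClosedFibres : ∀ {n} → Vec Bool n → Family n → Set
LexDownClosedFibres J A = ∀ z {x y} → supp⊆ x J ≡ true → supp⊆ y J ≡ true →
                          lexLt x y ≡ true → merge J z y ∈F A → merge J z x ∈F A

H-lexDownClosedFibres : ∀ {n} r {J : Vec Bool n} → norm J ≤ 2 → LexDownClosedFibres J (H r)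
H-lexDownClosedFibres r {J} ∣J∣≤2 z {x} {y} x⊆J y⊆J x≺y =
  H-≤-closed r (merge J z x) (merge J z y)
    (lexLt⇒norm-merge-≤ J z x y ∣J∣≤2 (supp⊆⇒SupportedIn x J x⊆J) (supp⊆⇒SupportedIn y J y⊆J) x≺y)

restrict∉lexPredecessors : ∀ {n} (J z : Vec Bool n) → lexPredecessors J z (restrict J z) ≡ false
restrict∉lexPredecessors J z rewrite lexLt-irrefl (restrict J z) = ∧-zeroʳ (supp⊆ (restrict J z) J)

module _ {n} (J : Vec Bool n) (A : Family n) (z : Vec Bool n) where

  merge-restrict∈⁺ : z ∈F A → merge J z (restrict J z) ∈F A
  merge-restrict∈⁺ = subst (_∈F A) (sym (merge-restrict J z))

  merge-restrict∈⁻ : merge J z (restrict J z) ∈F A → z ∈F A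
  merge-restrict∈⁻ = subst (_∈F A) (merge-restrict J z)

  restrict∈fibre : z ∈F A → restrict J z ∈F fibre J A z
  restrict∈fibre z∈A = ∧≡true⁺ (supp⊆-restrict J z) (merge-restrict∈⁺ z∈A)

  lexPredecessors⊆fibre : LexDownClosedFibres J A → z ∈F A → lexPredecessors J z ⊆F fibre J A z
  lexPredecessors⊆fibre down z∈A w w≺z with ∧≡true⁻ w≺z
  ... | w⊆J , w≺y = ∧≡true⁺ w⊆J (down z w⊆J (supp⊆-restrict J z) w≺y (merge-restrict∈⁺ z∈A))

  fibre⊆lexPredecessors : LexDownClosedFibres J A → ¬ z ∈F A → fibre J A z ⊆F lexPredecessors J z
  fibre⊆lexPredecessors down z∉A w w∈fibre with ∧≡true⁻ w∈fibre | lexLt-trichotomy w (restrict J z)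
  ... | w⊆J , _   | inj₁ w≺y = ∧≡true⁺ w⊆J w≺y
  ... | _   , w∈A | inj₂ (inj₁ refl) = ⊥-elim (z∉A (merge-restrict∈⁻ w∈A))
  ... | w⊆J , w∈A | inj₂ (inj₂ y≺w) =
    ⊥-elim (z∉A (merge-restrict∈⁻ (down z (supp⊆-restrict J z) w⊆J y≺w w∈A)))

lexDownClosedFibres⇒JCompressed : ∀ {n} {J : Vec Bool n} {A : Family n} →
                                  LexDownClosedFibres J A → JCompressed J A
lexDownClosedFibres⇒JCompressed {J = J} {A} down z with A z ≟ true
... | yes z∈A rewrite z∈A = <ᵇ≡true (count-mono-< (lexPredecessors⊆fibre J A z down z∈A)
                                                   (restrict∉lexPredecessors J z)
                                                   (restrict∈fibre J A z z∈A))
... | no z∉A rewrite ¬-not z∉A = <ᵇ≡false (count-mono (fibre⊆lexPredecessors J A z down z∉A))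

H-twoCompressed : ∀ {n} r → TwoCompressed {n} (H r)
H-twoCompressed r J ∣J∣≤2 = lexDownClosedFibres⇒JCompressed (H-lexDownClosedFibres r ∣J∣≤2)

fibre-mono : ∀ {n} {J z : Vec Bool n} {A B : Family n} → A ⊆F B → fibre J A z ⊆F fibre J B z
fibre-mono {J = J} {z} A⊆B w w∈fibre with ∧≡true⁻ w∈fibre
... | w⊆J , w∈A = ∧≡true⁺ w⊆J (A⊆B (merge J z w) w∈A)

C-mono : ∀ {n} (J : Vec Bool n) {A B : Family n} → A ⊆F B → C J A ⊆F C J B
C-mono J A⊆B z z∈CA = <ᵇ≡true (<-≤-trans (<ᵇ≡true⁻ z∈CA) (count-mono (fibre-mono A⊆B)))

proposition2p17 : (n r : ℕ) → r ≤ n →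
    TwoCompressed {n} (H r)
    × ((A : Family n) (J : Vec Bool n) → norm J ≤ 2 → H r ⊆F A → H r ⊆F C J A)
    × ((A : Family n) (J : Vec Bool n) → norm J ≤ 2 → A ⊆F H r → C J A ⊆F H r)
proposition2p17 n r _ = H-twoCompressed r , H⊆C , C⊆H
  where
  H⊆C : (A : Family n) (J : Vec Bool n) → norm J ≤ 2 → H r ⊆F A → H r ⊆F C J A
  H⊆C A J ∣J∣≤2 H⊆A z z∈H = C-mono J H⊆A z (trans (H-twoCompressed r J ∣J∣≤2 z) z∈H)

  C⊆H : (A : Family n) (J : Vec Bool n) → norm J ≤ 2 → A ⊆F H r → C J A ⊆F H r
  C⊆H A J ∣J∣≤2 A⊆H z z∈CA = trans (sym (H-twoCompressed r J ∣J∣≤2 z)) (C-mono J A⊆H z z∈CA)
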